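{- Let $P$ be a process template with reachability-unwinding $P^{\multimap}$. Then $\mathrm{exec}^{\mathrm{fin}}_{\mathcal P}=\{\pi^{\circledcirc}\mid \pi \text{ is a finite run of the transition system } P^{\multimap}\}$ and $\mathrm{exec}^{\infty}_{\mathcal P}\subseteq\{\pi^{\circledcirc}\mid \pi \text{ is an infinite run of the transition system } P^{\multimap}\}$.
   Context: Fix an integer $k\ge 1$ and a finite set $\Sigma_{\mathrm{actn}}$ of rendezvous actions; let $\Sigma_{\mathrm{rdz}}=\bigcup_{a\in\Sigma_{\mathrm{actn}}}\{a_1,\dots,a_k\}$ and let $\mathfrak b$ be a fresh broadcast symbol. A process template is a finite labeled transition system $P=(S,I,R,\Sigma_{\mathrm{rdz}}\cup\{\mathfrak b\})$ with finite state set $S$, initial states $I\subseteq S$ and edges $R\subseteq S\times(\Sigma_{\mathrm{rdz}}\cup\{\mathfrak b\})\times S$, such that every $s\in S$ has an outgoing edge $(s,\mathfrak b,s')\in R$ and every $\varsigma\in\Sigma_{\mathrm{rdz}}$ labels at most one edge of $R$. For $n\in\mathbb N$, the RB-system $\mathcal P^n$ is the transition system whose configurations are maps $f:[n]\to S$, whose initial configurations are those with $f(i)\in I$ for all $i$, and whose transitions are: broadcast transitions $(f,\mathfrak b,g)$ with $(f(i),\mathfrak b,g(i))\in R$ for all $i\in[n]$; and rendezvous transitions $(f,((i_1,a_1),\dots,(i_k,a_k)),g)$ where $a\in\Sigma_{\mathrm{actn}}$, $i_1,\dots,i_k\in[n]$ are pairwise distinct, $(f(i_j),a_j,g(i_j))\in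 R$ for all $j\in[k]$, and $g(i)=f(i)$ for $i\notin\{i_1,\dots,i_k\}$. $\mathcal P$ is the union of all $\mathcal P^n$. A run is a finite or infinite path starting at an initial configuration. For a path $\pi=t_1t_2\cdots$ and process $i$, $\pi(i)$ is the sequence of edges of $P$ taken by process $i$: in a broadcast transition $(f,\mathfrak b,g)$ it takes $(f(i),\mathfrak b,g(i))$, in a rendezvous transition with $i=i_j$ it takes $(f(i),a_j,g(i))$, and transitions in which $i$ does not participate are skipped. The executions are $\mathrm{exec}_{\mathcal P}=\{\pi(1)\mid\pi\text{ a run of }\mathcal P\}$ (words over the alphabet $R$); $\mathrm{exec}^{\mathrm{fin}}_{\mathcal P}$ and $\mathrm{exec}^{\infty}_{\mathcal P}$ are its finite and infinite members. Reachability-unwinding: define for $i\ge 0$ sets $I_i,S_i\subseteq S$ and $R_i\subseteq R$ by $I_0=I$, $I_i=\{s\in S\mid (h,\mathfrak b,s)\in R\text{ for some }h\in S_{i-1}\}$ for $i>0$, and $(S_i,R_i)$ obtained by saturation: start with $S_i=I_i$, $R_i=\emptyset$, and repeatedly add an edge $e=(s,a_h,t)\in R\setminus R_i$ (with $a_h\in\Sigma_{\mathrm{rdz}}$) to $R_i$ and $t$ to $S_i$ whenever for every $l\in[k]$ there is an edge $(s',a_l,t')\in R$ with $s'\in S_i$, until a fixed point. Let $m$ be least such that $(S_{m+1},I_{m+1},R_{m+1})=(S_n,I_n,R_n)$ for some $n\le m$. $P^{\multimap}$ is the transition system with states $\bigcup_{i=0}^m S_i\times\{i\}$, initial states $I\times\{0\}$,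 rendezvous edges $((s,i),\varsigma,(t,i))$ for $(s,\varsigma,t)\in R_i$, and broadcast edges $((s,i),\mathfrak b,(t,i+1))$ for $i<m$, $s\in S_i$, $(s,\mathfrak b,t)\in R$, and $((s,m),\mathfrak b,(t,n))$ for $s\in S_m$, $(s,\mathfrak b,t)\in R$. A run of $P^{\multimap}$ is a (finite or infinite) sequence of consecutive edges of $P^{\multimap}$ starting at an initial state. The operation $\circledcirc$ removes component numbers, mapping an edge $((s,i),\sigma,(t,j))$ to $(s,\sigma,t)\in R$, applied letterwise to sequences. -}

module Defs where

open import Data.Nat using (ℕ; zero; suc; _≤_; _<_)
open import Data.Fin using (Fin; _≟_)
open import Data.Fin.Properties using (any?)
open import Data.Bool using (Bool; T)
open import Data.Product using (Σ; ∃; _×_; _,_; proj₁; proj₂)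
open import Data.Maybe using (Maybe; just; nothing)
open import Data.List using (List; map; upTo; catMaybes)
open import Relation.Nullary using (¬_; yes; no)
open import Relation.Binary.PropositionalEquality using (_≡_; _≢_)
open import Function.Definitions using (Injective)
open import Function.Bundles using (_⇔_)

-- Labels: rendezvous symbols a_j (a an action, j ∈ [k]) and the broadcast 𝔟.
-- Actions are Fin nA; the index j ∈ [k] is represented by Fin k.

data Label (nA k : ℕ) : Set where
  rdz : Fin nA → Fin k → Label nA k
  bc  : Label nA k

record Template (nA k : ℕ) : Set where
  field
    nS   : ℕ
    init : Fin nS → Bool
    R    : Fin nS → Label nA k → Fin nS → Bool
    bcTotal : ∀ s → ∃ λ t → T (R s bc t)
    rdzUnique : ∀ a j s t s′ t′ → T (R s (rdz a j) t) → T (R s′ (rdz a j) t′)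
                → (s ≡ s′) × (t ≡ t′)

module _ {nA k : ℕ} (P : Template nA k) where
  open Template P

  -- edges of P (as triples; words over R are lists / streams of these)
  Edge : Set
  Edge = Fin nS × Label nA k × Fin nS

  -- The RB-system 𝒫ⁿ.  Processes [n] are Fin n; process 1 is Fin.zero.

  Config : ℕ → Set
  Config n = Fin n → Fin nS

  InitialConfig : ∀ {n} → Config n → Set
  InitialConfig f = ∀ i → T (init (f i))

  data TLabel (n : ℕ) : Set where
    bcL  : TLabel n
    -- rendezvous on action a; process ι j plays a_j
    rdzL : Fin nA → (Fin k → Fin n) → TLabel n

  data Step {n : ℕ} : Config n → TLabel n → Config n → Set where
    bcS  : ∀ {f g} → (∀ i → T (R (f i) bc (g i))) → Step f bcL g
    rdzS : ∀ {f g a ι} → Injective _≡_ _≡_ ι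
           → (∀ j → T (R (f (ι j)) (rdz a j) (g (ι j))))
           → (∀ i → (∀ j → ι j ≢ i) → g i ≡ f i)
           → Step f (rdzL a ι) g

  edgeOf : ∀ {n} → Fin n → Config n → TLabel n → Config n → Maybe Edge
  edgeOf i f bcL g = just (f i , bc , g i)
  edgeOf i f (rdzL a ι) g with any? (λ j → ι j ≟ i)
  ... | yes (j , _) = just (f i , rdz a j , g i)
  ... | no _        = nothing

  -- A path of 𝒫ⁿ is given by configurations c t and labels l t (t ∈ ℕ).
  -- The t-th transition is (c t, l t, c (suc t)).
  FinRunRB : (n L : ℕ) → (ℕ → Config n) → (ℕ → TLabel n) → Set
  FinRunRB n L c l = InitialConfig (c 0) × (∀ t → t < L → Step (c t) (l t) (c (suc t)))

  InfRunRB : (n : ℕ) → (ℕ → Config n) → (ℕ → TLabel n) → Set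
  InfRunRB n c l = InitialConfig (c 0) × (∀ t → Step (c t) (l t) (c (suc t)))

  projPrefix : ∀ {n} → Fin n → ℕ → (ℕ → Config n) → (ℕ → TLabel n) → List Edge
  projPrefix i L c l = catMaybes (map (λ t → edgeOf i (c t) (l t) (c (suc t))) (upTo L))

  -- finite executions: finite words π(1) for π a (finite or infinite) run
  ExecFin : List Edge → Set
  ExecFin w = ∃ λ n → Σ (ℕ → Config (suc n)) λ c → Σ (ℕ → TLabel (suc n)) λ l →
      (∃ λ L → FinRunRB (suc n) L c l × projPrefix Fin.zero L c l ≡ w)
    ⊎′ (InfRunRB (suc n) c l × ∃ λ N →
          (∀ t → N ≤ t → edgeOf Fin.zero (c t) (l t) (c (suc t)) ≡ nothing)
        × projPrefix Fin.zero N c l ≡ w)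
    where open import Data.Sum renaming (_⊎_ to _⊎′_)
          import Data.Fin as Fin

  -- infinite executions: π(1) is the infinite word w; σ enumerates (strictly
  -- increasingly) exactly the transitions in which process 1 participates
  ExecInf : (ℕ → Edge) → Set
  ExecInf w = ∃ λ n → Σ (ℕ → Config (suc n)) λ c → Σ (ℕ → TLabel (suc n)) λ l →
      InfRunRB (suc n) c l × Σ (ℕ → ℕ) λ σ →
        (∀ j → σ j < σ (suc j))
      × (∀ j → edgeOf Fin.zero (c (σ j)) (l (σ j)) (c (suc (σ j))) ≡ just (w j))
      × (∀ t → edgeOf Fin.zero (c t) (l t) (c (suc t)) ≢ nothing → ∃ λ j → σ j ≡ t)
    where import Data.Fin as Fin

  -- Reachability-unwinding.  (S_i, R_i) is the least fixed point of the
  -- saturation starting from I_i.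

  mutual
    data SatS (I : Fin nS → Set) : Fin nS → Set where
      fromI : ∀ {s} → I s → SatS I s
      target : ∀ {s a h t} → SatR I s a h t → SatS I t

    data SatR (I : Fin nS → Set) : Fin nS → Fin nA → Fin k → Fin nS → Set where
      add : ∀ {s a h t} → T (R s (rdz a h) t)
            → (∀ l′ → ∃ λ s′ → ∃ λ t′ → T (R s′ (rdz a l′) t′) × SatS I s′)
            → SatR I s a h t

  Iᵤ : ℕ → Fin nS → Set
  Iᵤ zero s = T (init s)
  Iᵤ (suc i) s = ∃ λ h → SatS (Iᵤ i) h × T (R h bc s)

  Sᵤ : ℕ → Fin nS → Set
  Sᵤ i = SatS (Iᵤ i)

  Rᵤ : ℕ → Fin nS → Fin nA → Fin k → Fin nS → Set
  Rᵤ i = SatR (Iᵤ i)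

  SameLevel : ℕ → ℕ → Set
  SameLevel i j = (∀ s → Sᵤ i s ⇔ Sᵤ j s) × (∀ s → Iᵤ i s ⇔ Iᵤ j s)
                × (∀ s a h t → Rᵤ i s a h t ⇔ Rᵤ j s a h t)

  UnwindBound : ℕ → ℕ → Set
  UnwindBound m n = n ≤ m × SameLevel (suc m) n
                  × (∀ m′ → m′ < m → ∀ n′ → n′ ≤ m′ → ¬ SameLevel (suc m′) n′)

  UState : Set
  UState = Fin nS × ℕ

  data UEdge (m n : ℕ) : UState → Label nA k → UState → Set where
    rdzE : ∀ {i s a h t} → i ≤ m → Rᵤ i s a h t → UEdge m n (s , i) (rdz a h) (t , i)
    bcE  : ∀ {i s t} → i < m → Sᵤ i s → T (R s bc t) → UEdge m n (s , i) bc (t , suc i)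
    bcM  : ∀ {s t} → Sᵤ m s → T (R s bc t) → UEdge m n (s , m) bc (t , n)

  UInitial : UState → Set
  UInitial (s , i) = T (init s) × i ≡ 0

  FinRunU : (m n L : ℕ) → (ℕ → UState) → (ℕ → Label nA k) → Set
  FinRunU m n L u l = UInitial (u 0) × (∀ t → t < L → UEdge m n (u t) (l t) (u (suc t)))

  InfRunU : (m n : ℕ) → (ℕ → UState) → (ℕ → Label nA k) → Set
  InfRunU m n u l = UInitial (u 0) × (∀ t → UEdge m n (u t) (l t) (u (suc t)))

  -- ⊚ : forget component numbers, letterwise
  forget : (ℕ → UState) → (ℕ → Label nA k) → ℕ → Edge
  forget u l t = (proj₁ (u t) , l t , proj₁ (u (suc t)))

  forgetPrefix : ℕ → (ℕ → UState) → (ℕ → Label nA k) → List Edge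
  forgetPrefix L u l = map (forget u l) (upTo L)

-- Along a run of the RB-system, all processes stay in S_i, where i is the component of P^⊸ obtained
-- by following the broadcasts made so far (a broadcast leads from i to i + 1, and from m back to n since
-- I_{m+1} = I_n). So every move of process 1 is an edge of P^⊸ between its consecutive observed
-- states (state, component), which gives the inclusions into the runs of P^⊸.
-- Conversely, by induction along the saturation, every state of S_i, where i is the component reached
-- after j broadcasts, is occupied by some process of a run with exactly j broadcasts. Runs with equally
-- many broadcasts can be executed side by side, so the partners needed by a rendezvous edge of R_i are
-- supplied by fresh processes, and process 1 of some RB-run follows any finite run of P^⊸.

module Submission where

open import Defs
open import Data.Nat using (ℕ; zero; suc; _+_; _≤_; _<_; z≤n; s≤s; _<?_; _≤?_)
open import Data.Nat.Properties using (≤-refl; ≤-trans; <-≤-trans; ≤-<-trans; <-irrefl; <⇒≤; ≰⇒>; m<n⇒m<1+n; m≤n⇒m<n∨m≡n)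
open import Data.Fin using (Fin; _≟_; _↑ˡ_; _↑ʳ_; splitAt) renaming (zero to fzero; suc to fsuc)
open import Data.Fin.Properties using (any?; ↑ˡ-injective; ↑ʳ-injective; splitAt-↑ˡ; splitAt-↑ʳ; splitAt⁻¹-↑ˡ; splitAt⁻¹-↑ʳ)
open import Data.Vec.Functional using (updateAt) renaming (_++_ to _⧺_)
open import Data.Vec.Functional.Properties using (updateAt-updates; updateAt-minimal; lookup-++ˡ; lookup-++ʳ)
open import Data.List using (List; []; _∷_; _++_; _∷ʳ_; map; upTo; applyUpTo; catMaybes)
open import Data.List.Properties using (map-upTo; applyUpTo-∷ʳ; catMaybes-++; ++-identityʳ)
open import Data.Maybe using (Maybe; just; nothing)
open import Data.Maybe.Properties using (just-injective)
open import Data.Product using (Σ; ∃; _×_; _,_; proj₁; proj₂)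
open import Data.Sum using (_⊎_; inj₁; inj₂)
open import Data.Bool using (T)
open import Data.Empty using (⊥-elim)
open import Function using (_∘_; const)
open import Function.Bundles using (_⇔_; Equivalence; mk⇔)
open import Function.Definitions using (Injective)
open import Relation.Nullary using (yes; no)
open import Relation.Binary.PropositionalEquality
  using (_≡_; _≢_; refl; sym; trans; cong; cong₂; subst; subst₂; module ≡-Reasoning)

map-upTo-suc : ∀ {A : Set} (f : ℕ → A) n → map f (upTo (suc n)) ≡ map f (upTo n) ∷ʳ f n
map-upTo-suc f n = begin
  map f (upTo (suc n))   ≡⟨ map-upTo f (suc n) ⟩
  applyUpTo f (suc n)    ≡⟨ applyUpTo-∷ʳ f n ⟨
  applyUpTo f n ∷ʳ f n   ≡⟨ cong (_∷ʳ f n) (map-upTo f n) ⟨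
  map f (upTo n) ∷ʳ f n  ∎
  where open ≡-Reasoning

just≢nothing : ∀ {A : Set} {x : A} → just x ≢ nothing
just≢nothing ()

↑ˡ≢↑ʳ : ∀ {M N} (x : Fin M) (y : Fin N) → x ↑ˡ N ≢ M ↑ʳ y
↑ˡ≢↑ʳ {M} {N} x y eq with trans (sym (splitAt-↑ˡ M x N)) (trans (cong (splitAt M) eq) (splitAt-↑ʳ M N y))
... | ()

updateAt-injective : ∀ {K M} {v : Fin K → Fin M} (i : Fin K) {z : Fin M} →
  Injective _≡_ _≡_ v → (∀ x → v x ≢ z) → Injective _≡_ _≡_ (updateAt v i (const z))
updateAt-injective {v = v} i {z} v-inj fresh {x} {y} eq with x ≟ i | y ≟ i
... | yes refl | yes refl = refl
... | yes refl | no y≢i   = ⊥-elim (fresh y (trans (sym (updateAt-minimal y i v y≢i)) (trans (sym eq) (updateAt-updates i v))))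
... | no x≢i   | yes refl = ⊥-elim (fresh x (trans (sym (updateAt-minimal x i v x≢i)) (trans eq (updateAt-updates i v))))
... | no x≢i   | no y≢i   = v-inj (trans (sym (updateAt-minimal x i v x≢i)) (trans eq (updateAt-minimal y i v y≢i)))

module LabelledPaths {X L : Set} (_—[_]→_ : X → L → X → Set) (padding : L) where

  infixr 5 _∷_
  infixl 5 _▷_

  data Path : X → X → Set where
    []  : ∀ {x} → Path x x
    _∷_ : ∀ {x a y z} → x —[ a ]→ y → Path y z → Path x z

  length : ∀ {x y} → Path x y → ℕ
  length []      = 0
  length (_ ∷ p) = suc (length p)

  _▷_ : ∀ {x y a z} → Path x y → y —[ a ]→ z → Path x z
  []       ▷ s = s ∷ []
  (s′ ∷ p) ▷ s = s′ ∷ (p ▷ s)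

  trace : ∀ {B : Set} → (X → L → X → B) → ∀ {x y} → Path x y → List B
  trace F []                    = []
  trace F (_∷_ {x} {a} {y} _ p) = F x a y ∷ trace F p

  trace-▷ : ∀ {B : Set} (F : X → L → X → B) {x y a z} (p : Path x y) (s : y —[ a ]→ z) →
    trace F (p ▷ s) ≡ trace F p ∷ʳ F y a z
  trace-▷ F []       s = refl
  trace-▷ F (s′ ∷ p) s = cong (_ ∷_) (trace-▷ F p s)

  trace-subst : ∀ {B : Set} (F : X → L → X → B) {x y z} (eq : y ≡ z) (p : Path x y) →
    trace F (subst (Path x) eq p) ≡ trace F p
  trace-subst F refl p = refl

  -- Beyond its end a path stays at its last state, with label padding.
  stateAt : ∀ {x y} → Path x y → ℕ → X
  stateAt {x} []      _       = x
  stateAt {x} (_ ∷ _) zero    = x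
  stateAt     (_ ∷ p) (suc t) = stateAt p t

  labelAt : ∀ {x y} → Path x y → ℕ → L
  labelAt []                _       = padding
  labelAt (_∷_ {a = a} _ _) zero    = a
  labelAt (_ ∷ p)           (suc t) = labelAt p t

  stateAt-zero : ∀ {x y} (p : Path x y) → stateAt p 0 ≡ x
  stateAt-zero []      = refl
  stateAt-zero (_ ∷ _) = refl

  stateAt-step : ∀ {x y} (p : Path x y) t → t < length p →
    stateAt p t —[ labelAt p t ]→ stateAt p (suc t)
  stateAt-step (s ∷ p) zero    _         = subst (_ —[ _ ]→_) (sym (stateAt-zero p)) s
  stateAt-step (_ ∷ p) (suc t) (s≤s t<n) = stateAt-step p t t<n

  applyUpTo-trace : ∀ {B : Set} (F : X → L → X → B) {x y} (p : Path x y) →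
    applyUpTo (λ t → F (stateAt p t) (labelAt p t) (stateAt p (suc t))) (length p) ≡ trace F p
  applyUpTo-trace F []      = refl
  applyUpTo-trace F (_∷_ {x} {a} s p) =
    cong₂ _∷_ (cong (F x a) (stateAt-zero p)) (applyUpTo-trace F p)

module _ {nA k : ℕ} (P : Template nA k) where
  open Template P

  module RB {N : ℕ} = LabelledPaths (Step P {N}) bcL

  edgeOf-rdz : ∀ {N} (q : Fin N) (f g : Config P N) a ι →
      (∃ λ j → ι j ≡ q × edgeOf P q f (rdzL a ι) g ≡ just (f q , rdz a j , g q))
    ⊎ ((∀ j → ι j ≢ q) × edgeOf P q f (rdzL a ι) g ≡ nothing)
  edgeOf-rdz q f g a ι with any? (λ j → ι j ≟ q)
  ... | yes (j , ιj≡q) = inj₁ (j , ιj≡q , refl)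
  ... | no  ¬hit       = inj₂ ((λ j ιj≡q → ¬hit (j , ιj≡q)) , refl)

  edgeOf-participant : ∀ {N} {q : Fin N} {f g : Config P N} {a ι j} →
    Injective _≡_ _≡_ ι → ι j ≡ q → edgeOf P q f (rdzL a ι) g ≡ just (f q , rdz a j , g q)
  edgeOf-participant {q = q} {f} {g} {a} {ι} {j} ι-inj ιj≡q with edgeOf-rdz q f g a ι
  ... | inj₁ (j′ , ιj′≡q , eq) = trans eq (cong (λ x → just (f q , rdz a x , g q)) (ι-inj (trans ιj′≡q (sym ιj≡q))))
  ... | inj₂ (absent , _)      = ⊥-elim (absent j ιj≡q)

  edgeOf-absent : ∀ {N} {q : Fin N} {f g : Config P N} {a ι} →
    (∀ j → ι j ≢ q) → edgeOf P q f (rdzL a ι) g ≡ nothing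
  edgeOf-absent {q = q} {f} {g} {a} {ι} absent with edgeOf-rdz q f g a ι
  ... | inj₁ (j , ιj≡q , _) = ⊥-elim (absent j ιj≡q)
  ... | inj₂ (_ , eq)       = eq

  infixl 5 _▷rdz_ _▷bc_

  data Trace {N} (f : Config P N) : ℕ → Config P N → Set where
    []     : Trace f 0 f
    _▷rdz_ : ∀ {j g h a ι} → Trace f j g → Step P g (rdzL a ι) h → Trace f j h
    _▷bc_  : ∀ {j g h} → Trace f j g → Step P g bcL h → Trace f (suc j) h

  toPath : ∀ {N j} {f g : Config P N} → Trace f j g → RB.Path f g
  toPath []         = RB.[]
  toPath (τ ▷rdz s) = toPath τ RB.▷ s
  toPath (τ ▷bc s)  = toPath τ RB.▷ s

  edges₀ : ∀ {N} {f g : Config P (suc N)} → RB.Path f g → List (Edge P)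
  edges₀ p = catMaybes (RB.trace (edgeOf P fzero) p)

  edges₀-▷ : ∀ {N} {f g h : Config P (suc N)} {lab} (p : RB.Path f g) (s : Step P g lab h) →
    edges₀ (p RB.▷ s) ≡ edges₀ p ++ catMaybes (edgeOf P fzero g lab h ∷ [])
  edges₀-▷ p s = trans (cong catMaybes (RB.trace-▷ (edgeOf P fzero) p s)) (catMaybes-++ (RB.trace (edgeOf P fzero) p) _)

  edges₀-▷-silent : ∀ {N} {f g h : Config P (suc N)} {lab} (p : RB.Path f g) (s : Step P g lab h) →
    edgeOf P fzero g lab h ≡ nothing → edges₀ (p RB.▷ s) ≡ edges₀ p
  edges₀-▷-silent p s silent =
    trans (edges₀-▷ p s) (trans (cong (λ e → edges₀ p ++ catMaybes (e ∷ [])) silent) (++-identityʳ _))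

  edges₀-▷-cong : ∀ {N N′} {f g h : Config P (suc N)} {f′ g′ h′ : Config P (suc N′)} {lab lab′}
    (p : RB.Path f g) (s : Step P g lab h) (p′ : RB.Path f′ g′) (s′ : Step P g′ lab′ h′) →
    edges₀ p ≡ edges₀ p′ → edgeOf P fzero g lab h ≡ edgeOf P fzero g′ lab′ h′ →
    edges₀ (p RB.▷ s) ≡ edges₀ (p′ RB.▷ s′)
  edges₀-▷-cong p s p′ s′ same-before same-edge =
    trans (edges₀-▷ p s) (trans (cong₂ (λ es e → es ++ catMaybes (e ∷ [])) same-before same-edge) (sym (edges₀-▷ p′ s′)))

  step-↑ˡ : ∀ {N₁ N₂} {g h : Config P N₁} (g₂ : Config P N₂) {a ι} →
    Step P g (rdzL a ι) h → Step P (g ⧺ g₂) (rdzL a ((_↑ˡ N₂) ∘ ι)) (h ⧺ g₂)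
  step-↑ˡ {N₁} {N₂} {g} {h} g₂ {a} {ι} (rdzS ι-inj e frame) =
    rdzS (ι-inj ∘ ↑ˡ-injective N₂ _ _)
      (λ j → subst₂ (λ x y → T (R x (rdz a j) y)) (sym (lookup-++ˡ g g₂ (ι j))) (sym (lookup-++ˡ h g₂ (ι j))) (e j))
      frame′
    where
      frame′ : ∀ i → (∀ j → ι j ↑ˡ N₂ ≢ i) → (h ⧺ g₂) i ≡ (g ⧺ g₂) i
      frame′ i absent with splitAt N₁ i in split
      ... | inj₁ x = frame x (λ j ιj≡x → absent j (trans (cong (_↑ˡ N₂) ιj≡x) (splitAt⁻¹-↑ˡ split)))
      ... | inj₂ _ = refl

  step-↑ʳ : ∀ {N₁ N₂} (g₁ : Config P N₁) {g h : Config P N₂} {a ι} →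
    Step P g (rdzL a ι) h → Step P (g₁ ⧺ g) (rdzL a ((N₁ ↑ʳ_) ∘ ι)) (g₁ ⧺ h)
  step-↑ʳ {N₁} {N₂} g₁ {g} {h} {a} {ι} (rdzS ι-inj e frame) =
    rdzS (ι-inj ∘ ↑ʳ-injective N₁ _ _)
      (λ j → subst₂ (λ x y → T (R x (rdz a j) y)) (sym (lookup-++ʳ g₁ g (ι j))) (sym (lookup-++ʳ g₁ h (ι j))) (e j))
      frame′
    where
      frame′ : ∀ i → (∀ j → N₁ ↑ʳ ι j ≢ i) → (g₁ ⧺ h) i ≡ (g₁ ⧺ g) i
      frame′ i absent with splitAt N₁ i in split
      ... | inj₁ _ = refl
      ... | inj₂ y = frame y (λ j ιj≡y → absent j (trans (cong (N₁ ↑ʳ_) ιj≡y) (splitAt⁻¹-↑ʳ split)))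

  step-bc-⧺ : ∀ {N₁ N₂} {g₁ h₁ : Config P N₁} {g₂ h₂ : Config P N₂} →
    Step P g₁ bcL h₁ → Step P g₂ bcL h₂ → Step P (g₁ ⧺ g₂) bcL (h₁ ⧺ h₂)
  step-bc-⧺ {N₁} {g₁ = g₁} {h₁} {g₂} {h₂} (bcS e₁) (bcS e₂) = bcS both
    where
      both : ∀ i → T (R ((g₁ ⧺ g₂) i) bc ((h₁ ⧺ h₂) i))
      both i with splitAt N₁ i
      ... | inj₁ x = e₁ x
      ... | inj₂ y = e₂ y

  initial-⧺ : ∀ {N₁ N₂} {f₁ : Config P N₁} {f₂ : Config P N₂} →
    InitialConfig P f₁ → InitialConfig P f₂ → InitialConfig P (f₁ ⧺ f₂)
  initial-⧺ {N₁} i₁ i₂ i with splitAt N₁ i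
  ... | inj₁ x = i₁ x
  ... | inj₂ y = i₂ y

  -- Broadcasts are synchronised, rendezvous are interleaved.
  parallel : ∀ {N₁ N₂ j} {f₁ g₁ : Config P N₁} {f₂ g₂ : Config P N₂} →
    Trace f₁ j g₁ → Trace f₂ j g₂ → Trace (f₁ ⧺ f₂) j (g₁ ⧺ g₂)
  parallel {g₁ = g₁} τ₁ (τ₂ ▷rdz s) = parallel τ₁ τ₂ ▷rdz step-↑ʳ g₁ s
  parallel {g₂ = g₂} (τ₁ ▷rdz s) τ₂ = parallel τ₁ τ₂ ▷rdz step-↑ˡ g₂ s
  parallel (τ₁ ▷bc s₁) (τ₂ ▷bc s₂)  = parallel τ₁ τ₂ ▷bc step-bc-⧺ s₁ s₂
  parallel [] []                    = []

  edgeOf-↑ˡ : ∀ {N₁ N₂} {g h : Config P (suc N₁)} (g₂ : Config P N₂) {a ι} (s : Step P g (rdzL a ι) h) →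
    edgeOf P fzero (g ⧺ g₂) (rdzL a ((_↑ˡ N₂) ∘ ι)) (h ⧺ g₂) ≡ edgeOf P fzero g (rdzL a ι) h
  edgeOf-↑ˡ {N₂ = N₂} {g} {h} g₂ {a} {ι} (rdzS ι-inj _ _) with edgeOf-rdz fzero g h a ι
  ... | inj₁ (j , ιj≡0 , eq) = trans (edgeOf-participant (ι-inj ∘ ↑ˡ-injective N₂ _ _) (cong (_↑ˡ N₂) ιj≡0)) (sym eq)
  ... | inj₂ (absent , eq)   = trans (edgeOf-absent (λ j → absent j ∘ ↑ˡ-injective N₂ _ _)) (sym eq)

  edges₀-parallel : ∀ {N₁ N₂ j} {f₁ g₁ : Config P (suc N₁)} {f₂ g₂ : Config P N₂}
    (τ₁ : Trace f₁ j g₁) (τ₂ : Trace f₂ j g₂) → edges₀ (toPath (parallel τ₁ τ₂)) ≡ edges₀ (toPath τ₁)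
  edges₀-parallel {g₁ = g₁} τ₁ (τ₂ ▷rdz s) =
    trans (edges₀-▷-silent (toPath (parallel τ₁ τ₂)) (step-↑ʳ g₁ s) (edgeOf-absent (λ _ ()))) (edges₀-parallel τ₁ τ₂)
  edges₀-parallel {g₂ = g₂} (τ₁ ▷rdz s) [] =
    edges₀-▷-cong (toPath (parallel τ₁ [])) (step-↑ˡ g₂ s) (toPath τ₁) s (edges₀-parallel τ₁ []) (edgeOf-↑ˡ g₂ s)
  edges₀-parallel {g₂ = g₂} (τ₁ ▷rdz s) (τ₂ ▷bc s₂) =
    edges₀-▷-cong (toPath (parallel τ₁ (τ₂ ▷bc s₂))) (step-↑ˡ g₂ s) (toPath τ₁) s
      (edges₀-parallel τ₁ (τ₂ ▷bc s₂)) (edgeOf-↑ˡ g₂ s)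
  edges₀-parallel (τ₁ ▷bc s₁) (τ₂ ▷bc s₂) =
    edges₀-▷-cong (toPath (parallel τ₁ τ₂)) (step-bc-⧺ s₁ s₂) (toPath τ₁) s₁ (edges₀-parallel τ₁ τ₂) refl
  edges₀-parallel [] [] = refl

  afterRendezvous : ∀ {N} → Config P N → (Fin k → Fin N) → (Fin k → Fin nS) → Config P N
  afterRendezvous g ι t i with any? (λ j → ι j ≟ i)
  ... | yes (j , _) = t j
  ... | no _        = g i

  afterRendezvous-participant : ∀ {N} (g : Config P N) {ι} (t : Fin k → Fin nS) →
    Injective _≡_ _≡_ ι → ∀ j → afterRendezvous g ι t (ι j) ≡ t j
  afterRendezvous-participant g {ι} t ι-inj j with any? (λ j′ → ι j′ ≟ ι j)
  ... | yes (j′ , ιj′≡ιj) = cong t (ι-inj ιj′≡ιj)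
  ... | no ¬hit           = ⊥-elim (¬hit (j , refl))

  afterRendezvous-absent : ∀ {N} (g : Config P N) {ι} (t : Fin k → Fin nS) i →
    (∀ j → ι j ≢ i) → afterRendezvous g ι t i ≡ g i
  afterRendezvous-absent g {ι} t i absent with any? (λ j → ι j ≟ i)
  ... | yes (j , ιj≡i) = ⊥-elim (absent j ιj≡i)
  ... | no _           = refl

  rendezvous-step : ∀ {N} (g : Config P N) {ι a} {t : Fin k → Fin nS} → Injective _≡_ _≡_ ι →
    (∀ j → T (R (g (ι j)) (rdz a j) (t j))) → Step P g (rdzL a ι) (afterRendezvous g ι t)
  rendezvous-step g {ι} {a} {t} ι-inj e =
    rdzS ι-inj
      (λ j → subst (T ∘ R (g (ι j)) (rdz a j)) (sym (afterRendezvous-participant g t ι-inj j)) (e j))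
      (afterRendezvous-absent g t)

  -- Every state has a broadcast successor, so a broadcast can send one chosen process anywhere it may go.
  afterBroadcast : ∀ {N} → Config P N → Fin N → Fin nS → Config P N
  afterBroadcast g p t = updateAt (λ i → proj₁ (bcTotal (g i))) p (const t)

  broadcast-step : ∀ {N} (g : Config P N) p {t} → T (R (g p) bc t) → Step P g bcL (afterBroadcast g p t)
  broadcast-step g p {t} e = bcS moved
    where
      moved : ∀ i → T (R (g i) bc (afterBroadcast g p t i))
      moved i with i ≟ p
      ... | yes refl = subst (T ∘ R (g p) bc) (sym (updateAt-updates p _)) e
      ... | no i≢p   = subst (T ∘ R (g i) bc) (sym (updateAt-minimal i p _ i≢p)) (proj₂ (bcTotal (g i)))

  record Reaching (j : ℕ) {K : ℕ} (targets : Fin K → Fin nS) : Set where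
    field
      N             : ℕ
      start end     : Config P N
      initial       : InitialConfig P start
      run           : Trace start j end
      pos           : Fin K → Fin N
      pos-injective : Injective _≡_ _≡_ pos
      pos-reaches   : ∀ x → end (pos x) ≡ targets x

  Reaching₁ : ℕ → Fin nS → Set
  Reaching₁ j s = Reaching j {1} (const s)

  reaching-initial : ∀ {s} → T (init s) → Reaching₁ 0 s
  reaching-initial {s} s∈I = record
    { N = 1 ; start = const s ; end = const s ; initial = const s∈I ; run = []
    ; pos = const fzero ; pos-injective = λ { {fzero} {fzero} _ → refl } ; pos-reaches = λ _ → refl }

  reaching-bc : ∀ {j s t} → Reaching₁ j s → T (R s bc t) → Reaching₁ (suc j) t
  reaching-bc {t = t} B e = record
    { N = N ; start = start ; end = afterBroadcast end (pos fzero) t ; initial = initial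
    ; run = run ▷bc broadcast-step end (pos fzero) (subst (λ x → T (R x bc t)) (sym (pos-reaches fzero)) e)
    ; pos = pos ; pos-injective = pos-injective ; pos-reaches = λ { fzero → updateAt-updates (pos fzero) _ } }
    where open Reaching B

  reaching-rdz : ∀ {j a} {s t : Fin k → Fin nS} → Reaching j s → (∀ l → T (R (s l) (rdz a l) (t l))) → Reaching j t
  reaching-rdz {a = a} {t = t} B e = record
    { N = N ; start = start ; end = afterRendezvous end pos t ; initial = initial
    ; run = run ▷rdz rendezvous-step end pos-injective
              (λ l → subst (λ x → T (R x (rdz a l) (t l))) (sym (pos-reaches l)) (e l))
    ; pos = pos ; pos-injective = pos-injective ; pos-reaches = afterRendezvous-participant end t pos-injective }
    where open Reaching B

  reaching-one : ∀ {j K t} {targets : Fin K → Fin nS} → Reaching j targets → ∀ x → targets x ≡ t → Reaching₁ j t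
  reaching-one B x tx≡t = record
    { N = N ; start = start ; end = end ; initial = initial ; run = run
    ; pos = const (pos x) ; pos-injective = λ { {fzero} {fzero} _ → refl } ; pos-reaches = λ _ → trans (pos-reaches x) tx≡t }
    where open Reaching B

  silentTrace : ∀ j → Trace {0} (λ ()) j (λ ())
  silentTrace zero    = []
  silentTrace (suc j) = silentTrace j ▷bc bcS (λ ())

  reaching-all : ∀ {j K} {targets : Fin K → Fin nS} → (∀ x → Reaching₁ j (targets x)) → Reaching j targets
  reaching-all {j} {zero} _ = record
    { N = 0 ; start = λ () ; end = λ () ; initial = λ () ; run = silentTrace j
    ; pos = λ () ; pos-injective = λ { {()} } ; pos-reaches = λ () }
  reaching-all {j} {suc K} {targets} Bs = record
    { N = B₀.N + Bₛ.N ; start = B₀.start ⧺ Bₛ.start ; end = B₀.end ⧺ Bₛ.end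
    ; initial = initial-⧺ B₀.initial Bₛ.initial ; run = parallel B₀.run Bₛ.run
    ; pos = pos ; pos-injective = pos-injective ; pos-reaches = pos-reaches }
    where
      module B₀ = Reaching (Bs fzero)
      module Bₛ = Reaching (reaching-all (Bs ∘ fsuc))
      pos : Fin (suc K) → Fin (B₀.N + Bₛ.N)
      pos fzero    = B₀.pos fzero ↑ˡ Bₛ.N
      pos (fsuc x) = B₀.N ↑ʳ Bₛ.pos x
      pos-injective : Injective _≡_ _≡_ pos
      pos-injective {fzero}  {fzero}  _  = refl
      pos-injective {fzero}  {fsuc _} eq = ⊥-elim (↑ˡ≢↑ʳ _ _ eq)
      pos-injective {fsuc _} {fzero}  eq = ⊥-elim (↑ˡ≢↑ʳ _ _ (sym eq))
      pos-injective {fsuc _} {fsuc _} eq = cong fsuc (Bₛ.pos-injective (↑ʳ-injective B₀.N _ _ eq))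
      pos-reaches : ∀ x → (B₀.end ⧺ Bₛ.end) (pos x) ≡ targets x
      pos-reaches fzero    = trans (lookup-++ˡ B₀.end Bₛ.end _) (B₀.pos-reaches fzero)
      pos-reaches (fsuc x) = trans (lookup-++ʳ B₀.end Bₛ.end _) (Bₛ.pos-reaches x)

  erase : UState P → Label nA k → UState P → Edge P
  erase x lb y = proj₁ x , lb , proj₁ y

  projPrefix-suc : ∀ {N} (q : Fin N) c l t →
    projPrefix P q (suc t) c l ≡ projPrefix P q t c l ++ catMaybes (edgeOf P q (c t) (l t) (c (suc t)) ∷ [])
  projPrefix-suc q c l t = trans (cong catMaybes (map-upTo-suc edgeAt t)) (catMaybes-++ (map edgeAt (upTo t)) _)
    where
      edgeAt : ℕ → Maybe (Edge P)
      edgeAt t = edgeOf P q (c t) (l t) (c (suc t))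

  module Unwinding (m n : ℕ) (bound : UnwindBound P m n) where

    n≤m : n ≤ m
    n≤m = proj₁ bound

    I[1+m]⇒I[n] : ∀ s → Iᵤ P (suc m) s → Iᵤ P n s
    I[1+m]⇒I[n] s = Equivalence.to (proj₁ (proj₂ (proj₁ (proj₂ bound))) s)

    I[n]⇒I[1+m] : ∀ s → Iᵤ P n s → Iᵤ P (suc m) s
    I[n]⇒I[1+m] s = Equivalence.from (proj₁ (proj₂ (proj₁ (proj₂ bound))) s)

    next : ℕ → ℕ
    next i with i <? m
    ... | yes _ = suc i
    ... | no  _ = n

    next≤m : ∀ i → next i ≤ m
    next≤m i with i <? m
    ... | yes i<m = i<m
    ... | no  _   = n≤m

    component : ℕ → ℕ
    component zero    = 0
    component (suc j) = next (component j)

    component≤m : ∀ j → component j ≤ m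
    component≤m zero    = z≤n
    component≤m (suc j) = next≤m (component j)

    Iᵤ-next⇒Iᵤ-suc : ∀ {i s} → i ≤ m → Iᵤ P (next i) s → Iᵤ P (suc i) s
    Iᵤ-next⇒Iᵤ-suc {i} {s} i≤m s∈I with i <? m
    ... | yes _   = s∈I
    ... | no  i≮m with m≤n⇒m<n∨m≡n i≤m
    ...   | inj₁ i<m  = ⊥-elim (i≮m i<m)
    ...   | inj₂ refl = I[n]⇒I[1+m] s s∈I

    uedge-bc : ∀ {i s t} → i ≤ m → Sᵤ P i s → T (R s bc t) → UEdge P m n (s , i) bc (t , next i)
    uedge-bc {i} i≤m s∈S e with i <? m
    ... | yes i<m = bcE i<m s∈S e
    ... | no  i≮m with m≤n⇒m<n∨m≡n i≤m
    ...   | inj₁ i<m  = ⊥-elim (i≮m i<m)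
    ...   | inj₂ refl = bcM s∈S e

    uedge-bc-next : ∀ {i s t i′} → UEdge P m n (s , i) bc (t , i′) → i′ ≡ next i
    uedge-bc-next {i} (bcE i<m _ _) with i <? m
    ... | yes _   = refl
    ... | no  i≮m = ⊥-elim (i≮m i<m)
    uedge-bc-next (bcM _ _) with m <? m
    ... | yes m<m = ⊥-elim (<-irrefl refl m<m)
    ... | no  _   = refl

    uedge-target : ∀ {s i lb t i′} → UEdge P m n (s , i) lb (t , i′) → Sᵤ P i′ t
    uedge-target         (rdzE _ r)    = target r
    uedge-target         (bcE _ s∈S e) = fromI (_ , s∈S , e)
    uedge-target {t = t} (bcM s∈S e)   = fromI (I[1+m]⇒I[n] t (_ , s∈S , e))

    module U = LabelledPaths (UEdge P m n) bc

    after : ∀ {N} → TLabel P N → ℕ → ℕ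
    after bcL        = next
    after (rdzL _ _) = λ i → i

    after≤m : ∀ {N} (lab : TLabel P N) {i} → i ≤ m → after lab i ≤ m
    after≤m bcL        {i} _ = next≤m i
    after≤m (rdzL _ _) i≤m   = i≤m

    data ProcessStep {N} (q : Fin N) (f : Config P N) (lab : TLabel P N) (g : Config P N) (i i′ : ℕ) : Set where
      idle  : edgeOf P q f lab g ≡ nothing → g q ≡ f q → i′ ≡ i → ProcessStep q f lab g i i′
      moves : ∀ {lb} → edgeOf P q f lab g ≡ just (f q , lb , g q) → UEdge P m n (f q , i) lb (g q , i′) →
              ProcessStep q f lab g i i′

    processStep : ∀ {N i lab} {f g : Config P N} → i ≤ m → (∀ p → Sᵤ P i (f p)) → Step P f lab g →
      ∀ q → ProcessStep q f lab g i (after lab i)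
    processStep i≤m f∈S (bcS e) q = moves refl (uedge-bc i≤m (f∈S q) (e q))
    processStep {f = f} {g} i≤m f∈S (rdzS {a = a} {ι} _ e frame) q with edgeOf-rdz q f g a ι
    ... | inj₁ (j , refl , eq) = moves eq (rdzE i≤m (add (e j) (λ l → f (ι l) , g (ι l) , e l , f∈S (ι l))))
    ... | inj₂ (absent , eq)   = idle eq (frame q absent) refl

    step-preserves-Sᵤ : ∀ {N i lab} {f g : Config P N} → i ≤ m → (∀ p → Sᵤ P i (f p)) → Step P f lab g →
      ∀ p → Sᵤ P (after lab i) (g p)
    step-preserves-Sᵤ i≤m f∈S s p with processStep i≤m f∈S s p
    ... | idle _ g≡f i′≡i = subst₂ (Sᵤ P) (sym i′≡i) (sym g≡f) (f∈S p)
    ... | moves _ u       = uedge-target u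

    module Observation {N} (c : ℕ → Config P (suc N)) (l : ℕ → TLabel P (suc N)) (initial : InitialConfig P (c 0)) where

      StepsBefore : ℕ → Set
      StepsBefore t = ∀ s → s < t → Step P (c s) (l s) (c (suc s))

      earlier : ∀ {t} → StepsBefore (suc t) → StepsBefore t
      earlier steps s s<t = steps s (m<n⇒m<1+n s<t)

      componentAt : ℕ → ℕ
      componentAt zero    = 0
      componentAt (suc t) = after (l t) (componentAt t)

      observed : ℕ → UState P
      observed t = c t fzero , componentAt t

      edgeAt : ℕ → Maybe (Edge P)
      edgeAt t = edgeOf P fzero (c t) (l t) (c (suc t))

      invariant : ∀ t → StepsBefore t → componentAt t ≤ m × (∀ p → Sᵤ P (componentAt t) (c t p))
      invariant zero    _     = z≤n , λ p → fromI (initial p)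
      invariant (suc t) steps with invariant t (earlier steps)
      ... | le , c∈S = after≤m (l t) le , step-preserves-Sᵤ le c∈S (steps t ≤-refl)

      observe : ∀ t → StepsBefore (suc t) →
        ProcessStep fzero (c t) (l t) (c (suc t)) (componentAt t) (componentAt (suc t))
      observe t steps with invariant t (earlier steps)
      ... | le , c∈S = processStep le c∈S (steps t ≤-refl) fzero

      observedPath : ∀ t → StepsBefore t →
        Σ (U.Path (observed 0) (observed t)) λ p → U.trace erase p ≡ projPrefix P fzero t c l
      observedPath zero    _     = U.[] , refl
      observedPath (suc t) steps with observedPath t (earlier steps) | observe t steps
      ... | p , eq | idle silent g≡f i′≡i =
        subst (U.Path (observed 0)) (sym (cong₂ _,_ g≡f i′≡i)) p , (begin
          U.trace erase (subst (U.Path (observed 0)) _ p)      ≡⟨ U.trace-subst erase _ p ⟩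
          U.trace erase p                                      ≡⟨ eq ⟩
          projPrefix P fzero t c l                             ≡⟨ ++-identityʳ _ ⟨
          projPrefix P fzero t c l ++ []                       ≡⟨ cong (λ e → projPrefix P fzero t c l ++ catMaybes (e ∷ [])) silent ⟨
          projPrefix P fzero t c l ++ catMaybes (edgeAt t ∷ []) ≡⟨ projPrefix-suc fzero c l t ⟨
          projPrefix P fzero (suc t) c l                       ∎)
        where open ≡-Reasoning
      ... | p , eq | moves e u = p U.▷ u , (begin
          U.trace erase (p U.▷ u)                               ≡⟨ U.trace-▷ erase p u ⟩
          U.trace erase p ∷ʳ _                                  ≡⟨ cong (_∷ʳ _) eq ⟩
          projPrefix P fzero t c l ∷ʳ _                         ≡⟨ cong (λ e → projPrefix P fzero t c l ++ catMaybes (e ∷ [])) e ⟨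
          projPrefix P fzero t c l ++ catMaybes (edgeAt t ∷ []) ≡⟨ projPrefix-suc fzero c l t ⟨
          projPrefix P fzero (suc t) c l                        ∎)
        where open ≡-Reasoning

      prefix⇒run : ∀ L → StepsBefore L → ∃ λ L′ → Σ (ℕ → UState P) λ u → Σ (ℕ → Label nA k) λ lab →
        FinRunU P m n L′ u lab × forgetPrefix P L′ u lab ≡ projPrefix P fzero L c l
      prefix⇒run L steps with observedPath L steps
      ... | p , eq = U.length p , U.stateAt p , U.labelAt p ,
        (subst (UInitial P) (sym (U.stateAt-zero p)) (initial fzero , refl) , U.stateAt-step p) ,
        trans (trans (map-upTo _ _) (U.applyUpTo-trace erase p)) eq

      module Enumeration (steps : ∀ t → Step P (c t) (l t) (c (suc t))) (w : ℕ → Edge P) (σ : ℕ → ℕ)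
                        (σ-< : ∀ j → σ j < σ (suc j))
                        (σ-edge : ∀ j → edgeAt (σ j) ≡ just (w j))
                        (σ-onto : ∀ t → edgeAt t ≢ nothing → ∃ λ j → σ j ≡ t) where

        allSteps : ∀ t → StepsBefore t
        allSteps _ s _ = steps s

        idle-interval : ∀ {a} b → a ≤ b → (∀ t → a ≤ t → t < b → edgeAt t ≡ nothing) → observed b ≡ observed a
        idle-interval zero    z≤n  _      = refl
        idle-interval (suc b) a≤1+b silent with m≤n⇒m<n∨m≡n a≤1+b
        ... | inj₂ refl     = refl
        ... | inj₁ (s≤s a≤b) with observe b (allSteps (suc b)) | silent b a≤b ≤-refl
        ...   | idle _ g≡f i′≡i | _ =
          trans (cong₂ _,_ g≡f i′≡i) (idle-interval b a≤b (λ t a≤t t<b → silent t a≤t (m<n⇒m<1+n t<b)))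
        ...   | moves e _ | silent-b = ⊥-elim (just≢nothing (trans (sym e) silent-b))

        σ-mono : ∀ {j j′} → j ≤ j′ → σ j ≤ σ j′
        σ-mono {j′ = zero}   z≤n   = ≤-refl
        σ-mono {j′ = suc j′} j≤1+j′ with m≤n⇒m<n∨m≡n j≤1+j′
        ... | inj₁ (s≤s j≤j′) = ≤-trans (σ-mono j≤j′) (<⇒≤ (σ-< j′))
        ... | inj₂ refl       = ≤-refl

        unenumerated : ∀ t → (∀ j → σ j ≢ t) → edgeAt t ≡ nothing
        unenumerated t missed with edgeAt t in eq
        ... | nothing = refl
        ... | just _ with σ-onto t (just≢nothing ∘ trans (sym eq))
        ...   | j , σj≡t = ⊥-elim (missed j σj≡t)

        between : ∀ j t → σ j < t → t < σ (suc j) → edgeAt t ≡ nothing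
        between j t σj<t t<σ[1+j] = unenumerated t excluded
          where
            excluded : ∀ j′ → σ j′ ≢ t
            excluded j′ σj′≡t with j′ ≤? j
            ... | yes j′≤j = <-irrefl σj′≡t (≤-<-trans (σ-mono j′≤j) σj<t)
            ... | no  j′≰j = <-irrefl (sym σj′≡t) (<-≤-trans t<σ[1+j] (σ-mono (≰⇒> j′≰j)))

        before : ∀ t → t < σ 0 → edgeAt t ≡ nothing
        before t t<σ0 = unenumerated t λ j′ σj′≡t → <-irrefl (sym σj′≡t) (<-≤-trans t<σ0 (σ-mono z≤n))

        u : ℕ → UState P
        u j = observed (σ j)

        lab : ℕ → Label nA k
        lab j = proj₁ (proj₂ (w j))

        u-initial : UInitial P (u 0)
        u-initial = subst (UInitial P) (sym (idle-interval (σ 0) z≤n (λ t _ → before t))) (initial fzero , refl)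

        u-step : ∀ j → UEdge P m n (u j) (lab j) (u (suc j)) × forget P u lab j ≡ w j
        u-step j with observe (σ j) (allSteps (suc (σ j)))
        ... | idle silent _ _    = ⊥-elim (just≢nothing (trans (sym (σ-edge j)) silent))
        ... | moves {lb} e edge = subst₂ (UEdge P m n (u j)) lb≡lab arrives edge , forget-eq
          where
            arrives : observed (suc (σ j)) ≡ u (suc j)
            arrives = sym (idle-interval (σ (suc j)) (σ-< j) (between j))
            w-eq : w j ≡ (c (σ j) fzero , lb , c (suc (σ j)) fzero)
            w-eq = just-injective (trans (sym (σ-edge j)) e)
            lb≡lab : lb ≡ lab j
            lb≡lab = cong (proj₁ ∘ proj₂) (sym w-eq)
            forget-eq : forget P u lab j ≡ w j
            forget-eq = trans (cong₂ (λ b y → c (σ j) fzero , b , y) (sym lb≡lab) (cong proj₁ (sym arrives))) (sym w-eq)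

    exec-fin⇒run : ∀ {w} → ExecFin P w → ∃ λ L → Σ (ℕ → UState P) λ u → Σ (ℕ → Label nA k) λ l →
      FinRunU P m n L u l × forgetPrefix P L u l ≡ w
    exec-fin⇒run (_ , c , l , inj₁ (L , (initial , steps) , refl))     = Observation.prefix⇒run c l initial L steps
    exec-fin⇒run (_ , c , l , inj₂ ((initial , steps) , L , _ , refl)) = Observation.prefix⇒run c l initial L (λ t _ → steps t)

    exec-inf⇒run : ∀ {w} → ExecInf P w → Σ (ℕ → UState P) λ u → Σ (ℕ → Label nA k) λ l →
      InfRunU P m n u l × (∀ t → forget P u l t ≡ w t)
    exec-inf⇒run {w} (_ , c , l , (initial , steps) , σ , σ-< , σ-edge , σ-onto) =
      u , lab , (u-initial , proj₁ ∘ u-step) , proj₂ ∘ u-step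
      where open Observation c l initial
            open Enumeration steps w σ σ-< σ-edge σ-onto

    reach : ∀ j {s} → Sᵤ P (component j) s → Reaching₁ j s
    reach zero    (fromI s∈I) = reaching-initial s∈I
    reach (suc j) (fromI s∈I) with Iᵤ-next⇒Iᵤ-suc (component≤m j) s∈I
    ... | _ , h∈S , e = reaching-bc (reach j h∈S) e
    reach j (target (add {s} {a} {hh} {t} e partners)) =
      reaching-one (reaching-rdz (reaching-all (λ l → reach j (proj₂ (proj₂ (proj₂ (partners l)))))) edge)
                   hh (sym (proj₂ (rdzUnique a hh s t _ _ e (edge hh))))
      where
        edge : ∀ l → T (R (proj₁ (partners l)) (rdz a l) (proj₁ (proj₂ (partners l))))
        edge l = proj₁ (proj₂ (proj₂ (partners l)))

    record Simulation (x : UState P) (w : List (Edge P)) : Set where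
      field
        N j          : ℕ
        start end    : Config P (suc N)
        initial      : InitialConfig P start
        run          : Trace start j end
        component-eq : component j ≡ proj₂ x
        state-eq     : end fzero ≡ proj₁ x
        edges-eq     : edges₀ (toPath run) ≡ w

    simulation-initial : ∀ {x} → UInitial P x → Simulation x []
    simulation-initial {s , i} (s∈I , i≡0) = record
      { N = 0 ; j = 0 ; start = const s ; end = const s ; initial = const s∈I ; run = []
      ; component-eq = sym i≡0 ; state-eq = refl ; edges-eq = refl }

    simulation-bc : ∀ {s i t i′ w} → Simulation (s , i) w → T (R s bc t) → i′ ≡ next i →
      Simulation (t , i′) (w ∷ʳ (s , bc , t))
    simulation-bc {s} {i} {t} S e i′≡next = record
      { N = N ; j = suc j ; start = start ; end = afterBroadcast end fzero t ; initial = initial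
      ; run = run ▷bc step
      ; component-eq = trans (cong next component-eq) (sym i′≡next)
      ; state-eq = refl
      ; edges-eq = trans (edges₀-▷ (toPath run) step) (cong₂ (λ es s′ → es ∷ʳ (s′ , bc , t)) edges-eq state-eq) }
      where
        open Simulation S
        step : Step P end bcL (afterBroadcast end fzero t)
        step = broadcast-step end fzero (subst (λ x → T (R x bc t)) (sym state-eq) e)

    -- Process 1 plays a_hh; the other roles go to fresh processes run alongside with the same broadcasts.
    simulation-rdz : ∀ {s i a hh t w} → Rᵤ P i s a hh t → Simulation (s , i) w →
      Simulation (t , i) (w ∷ʳ (s , rdz a hh , t))
    simulation-rdz {s} {i} {a} {hh} {t} (add e partners) S = record
      { N = N + B.N ; j = j ; start = start ⧺ B.start ; end = end′ ; initial = initial-⧺ initial B.initial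
      ; run = parallel run B.run ▷rdz step
      ; component-eq = component-eq
      ; state-eq = moved
      ; edges-eq = trans (edges₀-▷ (toPath (parallel run B.run)) step)
                     (cong₂ _++_ (trans (edges₀-parallel run B.run) edges-eq) edge-eq) }
      where
        open Simulation S
        source goal : Fin k → Fin nS
        source l = proj₁ (partners l)
        goal   l = proj₁ (proj₂ (partners l))
        edge : ∀ l → T (R (source l) (rdz a l) (goal l))
        edge l = proj₁ (proj₂ (proj₂ (partners l)))
        module B = Reaching (reaching-all {targets = source}
          (λ l → reach j (subst (λ c → Sᵤ P c (source l)) (sym component-eq) (proj₂ (proj₂ (proj₂ (partners l)))))))
        unique : (s ≡ source hh) × (t ≡ goal hh)
        unique = rdzUnique a hh s t _ _ e (edge hh)
        ι : Fin k → Fin (suc N + B.N)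
        ι = updateAt ((suc N ↑ʳ_) ∘ B.pos) hh (const fzero)
        ι-injective : Injective _≡_ _≡_ ι
        ι-injective = updateAt-injective hh (B.pos-injective ∘ ↑ʳ-injective (suc N) _ _) (λ _ ())
        ι-hh : ι hh ≡ fzero
        ι-hh = updateAt-updates hh _
        at-sources : ∀ l → (end ⧺ B.end) (ι l) ≡ source l
        at-sources l with l ≟ hh
        ... | yes refl = trans (cong (end ⧺ B.end) ι-hh) (trans state-eq (proj₁ unique))
        ... | no l≢hh  = trans (cong (end ⧺ B.end) (updateAt-minimal l hh _ l≢hh))
                           (trans (lookup-++ʳ end B.end (B.pos l)) (B.pos-reaches l))
        end′ : Config P (suc (N + B.N))
        end′ = afterRendezvous (end ⧺ B.end) ι goal
        step : Step P (end ⧺ B.end) (rdzL a ι) end′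
        step = rendezvous-step (end ⧺ B.end) ι-injective
                 (λ l → subst (λ x → T (R x (rdz a l) (goal l))) (sym (at-sources l)) (edge l))
        moved : end′ fzero ≡ t
        moved = trans (cong end′ (sym ι-hh))
                  (trans (afterRendezvous-participant (end ⧺ B.end) goal ι-injective hh) (sym (proj₂ unique)))
        edge-eq : catMaybes (edgeOf P fzero (end ⧺ B.end) (rdzL a ι) end′ ∷ []) ≡ (s , rdz a hh , t) ∷ []
        edge-eq = cong (λ e → catMaybes (e ∷ [])) (trans (edgeOf-participant ι-injective ι-hh)
                    (cong₂ (λ x y → just (x , rdz a hh , y)) state-eq moved))

    simulation-step : ∀ {x lb y w} → UEdge P m n x lb y → Simulation x w → Simulation y (w ∷ʳ erase x lb y)
    simulation-step (rdzE _ r)    S = simulation-rdz r S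
    simulation-step u@(bcE _ _ e) S = simulation-bc S e (uedge-bc-next u)
    simulation-step u@(bcM _ e)   S = simulation-bc S e (uedge-bc-next u)

    simulate : ∀ L {u l} → FinRunU P m n L u l → Simulation (u L) (forgetPrefix P L u l)
    simulate zero    (u₀ , _) = simulation-initial u₀
    simulate (suc L) {u} {l} (u₀ , edges) =
      subst (Simulation (u (suc L))) (sym (map-upTo-suc (forget P u l) L))
        (simulation-step (edges L ≤-refl) (simulate L (u₀ , λ t t<L → edges t (m<n⇒m<1+n t<L))))

    simulation-exec : ∀ {x w} → Simulation x w → ExecFin P w
    simulation-exec {w = w} S =
      N , RB.stateAt p , RB.labelAt p ,
      inj₁ (RB.length p , (subst (InitialConfig P) (sym (RB.stateAt-zero p)) initial , RB.stateAt-step p) , projected)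
      where
        open Simulation S
        p : RB.Path start end
        p = toPath run
        projected : projPrefix P fzero (RB.length p) (RB.stateAt p) (RB.labelAt p) ≡ w
        projected = trans (cong catMaybes (trans (map-upTo _ _) (RB.applyUpTo-trace (edgeOf P fzero) p))) edges-eq

    run⇒exec-fin : ∀ {w} → (∃ λ L → Σ (ℕ → UState P) λ u → Σ (ℕ → Label nA k) λ l →
      FinRunU P m n L u l × forgetPrefix P L u l ≡ w) → ExecFin P w
    run⇒exec-fin (L , u , l , run , refl) = simulation-exec (simulate L run)

lemma5 : (nA k : ℕ) → 1 ≤ k → (P : Template nA k) → (m n : ℕ) → UnwindBound P m n
       → ((w : List (Edge P)) → ExecFin P w
            ⇔ (∃ λ L → Σ (ℕ → UState P) λ u → Σ (ℕ → Label nA k) λ l →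
                 FinRunU P m n L u l × forgetPrefix P L u l ≡ w))
       × ((w : ℕ → Edge P) → ExecInf P w
            → Σ (ℕ → UState P) λ u → Σ (ℕ → Label nA k) λ l →
                 InfRunU P m n u l × (∀ t → forget P u l t ≡ w t))
lemma5 _ _ _ P m n bound = (λ _ → mk⇔ exec-fin⇒run run⇒exec-fin) , λ _ → exec-inf⇒run
  where open Unwinding P m n bound
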